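{- Let $k\ge 1$ and $a_1,\ldots,a_k$ be positive integers, and let $G$ be a simple graph that is degree equivalent to the complete $k$-partite graph $K_{a_1,\ldots,a_k}$. If $G$ is not isomorphic to $K_{a_1,\ldots,a_k}$, then $\omega(G)\ge k+1$.
   Context: All graphs are finite simple graphs. Two graphs are degree equivalent if they have the same multiset of vertex degrees. $\omega(G)$ is the clique number of $G$. $K_{a_1,\ldots,a_k}$ is the complete $k$-partite graph with independent parts of sizes $a_1,\ldots,a_k$, any two vertices in different parts being adjacent. -}

module Defs where

open import Data.Nat using (ℕ; zero; suc; _+_)
open import Data.Bool using (Bool; true; false; not)
open import Data.Fin using (Fin; _≟_; splitAt)
import Data.Empty
open import Data.Sum using (inj₁; inj₂)
open import Relation.Binary.PropositionalEquality using (refl; cong)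
open import Relation.Binary.Core using (Rel)
open import Relation.Nullary using (yes; no)
open import Data.Vec using (Vec; []; _∷_)
open import Data.List using (List; map; filter; length; allFin)
open import Data.List.Relation.Binary.Permutation.Propositional using (_↭_)
open import Data.Product using (Σ; _×_; _,_)
open import Relation.Binary.PropositionalEquality using (_≡_)
open import Relation.Nullary using (¬_; does)
open import Relation.Nullary.Decidable using (⌊_⌋)
open import Function.Bundles using (_⤖_; Bijection)
open import Function.Definitions using (Injective)

record Graph (n : ℕ) : Set where
  field
    adj   : Fin n → Fin n → Bool
    sym   : ∀ i j → adj i j ≡ adj j i
    irrefl : ∀ i → adj i i ≡ false
open Graph public

degree : ∀ {n} → Graph n → Fin n → ℕ
degree G i = length (filter (λ j → adj G i j ≡? true) (allFin _))
  where
    open import Data.Bool.Properties using () renaming (_≟_ to _≡?_)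

degreeList : ∀ {n} → Graph n → List ℕ
degreeList {n} G = map (degree G) (allFin n)

DegreeEquivalent : ∀ {n m} → Graph n → Graph m → Set
DegreeEquivalent G H = degreeList G ↭ degreeList H

Isomorphic : ∀ {n m} → Graph n → Graph m → Set
Isomorphic {n} {m} G H =
  Σ (Fin n ⤖ Fin m) λ f →
    ∀ i j → adj H (Bijection.to f i) (Bijection.to f j) ≡ adj G i j

HasClique : ∀ {n} → Graph n → ℕ → Set
HasClique {n} G r =
  Σ (Fin r → Fin n) λ f → Injective _≡_ _≡_ f ×
    (∀ i j → ¬ i ≡ j → adj G (f i) (f j) ≡ true)

total : ∀ {k} → Vec ℕ k → ℕ
total []       = 0
total (a ∷ as) = a + total as

-- which part (Fin k) each vertex of K_{a_1..a_k} belongs to;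
-- vertices are numbered consecutively: first a_1 vertices in part 1, etc.
part : ∀ {k} (as : Vec ℕ k) → Fin (total as) → Fin k
part (a ∷ as) v with splitAt a v
... | inj₁ _ = Fin.zero
... | inj₂ w = Fin.suc (part as w)

completeMultipartite : ∀ {k} (as : Vec ℕ k) → Graph (total as)
completeMultipartite as = record
  { adj = λ u v → not ⌊ part as u ≟ part as v ⌋
  ; sym = λ u v → symAux (part as u) (part as v)
  ; irrefl = λ u → irrAux (part as u)
  }
  where
    symAux : ∀ {k} (x y : Fin k) → not ⌊ x ≟ y ⌋ ≡ not ⌊ y ≟ x ⌋
    symAux x y with x ≟ y | y ≟ x
    ... | yes _ | yes _ = refl
    ... | no _ | no _ = refl
    ... | yes p | no q = Data.Empty.⊥-elim (q (Relation.Binary.PropositionalEquality.sym p))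
    ... | no p | yes q = Data.Empty.⊥-elim (p (Relation.Binary.PropositionalEquality.sym q))
    irrAux : ∀ {k} (x : Fin k) → not ⌊ x ≟ x ⌋ ≡ false
    irrAux x with x ≟ x
    ... | yes _ = refl
    ... | no q = Data.Empty.⊥-elim (q refl)

-- Erdős: if G has no clique of size k + 1, there is a k-colouring c of its vertices with
-- deg u ≤ n − |class of u| for every u, and if equality holds everywhere then G is the complete
-- multipartite graph of c. When G has the degree sequence of K = K_{a_1,…,a_k}, the sum of
-- 1/(n − deg u) over the vertices is k for K, hence for G; but for G it is at most the sum of
-- 1/|class of u|, i.e. the number of nonempty classes of c, which is at most k. So every bound
-- is tight: G is the complete k-partite graph of c, and complete multipartite graphs with the
-- same degree sequence have the same class sizes, hence are isomorphic.

module Submission where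

open import Defs renaming (sym to adj-sym; irrefl to adj-irrefl)
open import Algebra.Properties.CommutativeSemigroup using (xy∙z≈xz∙y)
open import Data.Bool using (Bool; true; false; not; _∧_)
open import Data.Bool.Properties using (∧-assoc; ∧-comm; ∧-identityʳ; ∧-conicalˡ; ∧-conicalʳ)
import Data.Bool.Properties as Bool
open import Data.Fin using (Fin; zero; suc; _≟_; inject₁; fromℕ; punchIn; splitAt; _↑ʳ_)
open import Data.Fin.Properties using (fromℕ≢inject₁; inject₁-injective; splitAt-↑ʳ)
open import Data.Fin.Permutation using (Permutation; _⟨$⟩ʳ_; _⟨$⟩ˡ_; inverseˡ; inverseʳ; insert; insert-punchIn)
  renaming (id to idₚ)
open import Data.List using (map; filter; length; tabulate; allFin)
import Data.List.Properties as List
open import Data.List.Relation.Binary.Permutation.Propositional.Properties using (map⁺; ↭-length)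
open import Data.Nat using (ℕ; zero; suc; _+_; _*_; _∸_; _≤_; _≥_; _>_; z≤n; s≤s; _!; _≤?_; NonZero; ≢-nonZero)
import Data.Nat as ℕ
open import Data.Nat.Properties hiding (_≟_)
open import Data.Nat.Divisibility using (_∣_; ∣-trans; m∣m*n; m≤n⇒m!∣n!)
open import Data.Nat.DivMod using (_/_; m*[n/m]≡n; /-monoʳ-≤)
import Data.Nat.ListAction as List using (sum)
open import Data.Nat.ListAction.Properties using (sum-↭)
open import Algebra.Properties.Semiring.Sum +-*-semiring
  using (sum; sum-syntax; sum-cong-≗; sum-replicate-zero; sum-remove; ∑-distrib-+; ∑-comm; *-distribʳ-sum; *-distribˡ-sum)
open import Data.Product using (Σ-syntax; ∃; _×_; _,_; proj₁; proj₂)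
open import Data.Sum using (_⊎_; inj₁; inj₂)
open import Data.Vec using (Vec; _∷_)
open import Data.Vec.Relation.Unary.All using (All; _∷_)
import Data.Vec.Functional as Vector
open import Function using (_∘_; id; mk⇔)
open import Function.Properties.Inverse using (↔⇒⤖)
open import Relation.Binary.Definitions using (DecidableEquality)
open import Relation.Binary.PropositionalEquality
  using (_≡_; _≢_; refl; sym; trans; cong; cong₂; subst; subst₂; module ≡-Reasoning)
open import Relation.Nullary using (¬_; does; yes; no; contradiction)
open import Relation.Nullary.Decidable using (dec-true; dec-false; does-⇔; isYes≗does)

χ : Bool → ℕ
χ true  = 1
χ false = 0

count : ∀ {n} → (Fin n → Bool) → ℕ
count {n} P = ∑[ i < n ] χ (P i)

infixr 6 _∩_

_∩_ : ∀ {n} → (Fin n → Bool) → (Fin n → Bool) → Fin n → Bool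
(P ∩ Q) i = P i ∧ Q i

_⊆_ : ∀ {n} → (Fin n → Bool) → (Fin n → Bool) → Set
P ⊆ Q = ∀ i → P i ≡ true → Q i ≡ true

everywhere : ∀ {n} → Fin n → Bool
everywhere _ = true

∑-const : ∀ n a → ∑[ i < n ] a ≡ n * a
∑-const zero    a = refl
∑-const (suc n) a = cong (a +_) (∑-const n a)

∑-mono-≤ : ∀ {n} {f g : Fin n → ℕ} → (∀ i → f i ≤ g i) → sum f ≤ sum g
∑-mono-≤ {zero}  f≤g = z≤n
∑-mono-≤ {suc n} f≤g = +-mono-≤ (f≤g zero) (∑-mono-≤ (f≤g ∘ suc))

∑-mono-≤-tight : ∀ {n} {f g : Fin n → ℕ} → (∀ i → f i ≤ g i) → sum g ≤ sum f → ∀ i → f i ≡ g i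
∑-mono-≤-tight {suc n} {f} {g} f≤g g≤f zero = ≤-antisym (f≤g zero)
  (+-cancelʳ-≤ (sum (f ∘ suc)) (g zero) (f zero) (≤-trans (+-monoʳ-≤ (g zero) (∑-mono-≤ (f≤g ∘ suc))) g≤f))
∑-mono-≤-tight {suc n} {f} {g} f≤g g≤f (suc i) = ∑-mono-≤-tight (f≤g ∘ suc)
  (+-cancelˡ-≤ (f zero) _ _ (≤-trans (+-monoˡ-≤ (sum (g ∘ suc)) (f≤g zero)) g≤f)) i

+-mono-≤-tight : ∀ {a b c d} → a ≤ c → b ≤ d → a + b ≡ c + d → a ≡ c × b ≡ d
+-mono-≤-tight {a} {b} {c} {d} a≤c b≤d eq = +-cancelʳ-≡ b a c (trans eq (cong (c +_) (sym b≡d))) , b≡d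
  where
  b≡d : b ≡ d
  b≡d = ≤-antisym b≤d (+-cancelˡ-≤ c d b (≤-trans (≤-reflexive (sym eq)) (+-monoˡ-≤ b a≤c)))

χ-mono : ∀ {a b} → (a ≡ true → b ≡ true) → χ a ≤ χ b
χ-mono {false} _   = z≤n
χ-mono {true}  a⇒b rewrite a⇒b refl = ≤-refl

χ≡1 : ∀ {b} → χ b ≡ 1 → b ≡ true
χ≡1 {true} _ = refl

count-cong : ∀ {n} {P Q : Fin n → Bool} → (∀ i → P i ≡ Q i) → count P ≡ count Q
count-cong P≗Q = sum-cong-≗ (cong χ ∘ P≗Q)

count-everywhere : ∀ {n} → count {n} everywhere ≡ n
count-everywhere {n} = trans (∑-const n 1) (*-identityʳ n)

count-nowhere : ∀ {n} {P : Fin n → Bool} → (∀ i → P i ≡ false) → count P ≡ 0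
count-nowhere {n} none = trans (count-cong none) (sum-replicate-zero n)

count-mono : ∀ {n} {P Q : Fin n → Bool} → P ⊆ Q → count P ≤ count Q
count-mono P⊆Q = ∑-mono-≤ (λ i → χ-mono (P⊆Q i))

count-mono-tight : ∀ {n} {P Q : Fin n → Bool} → P ⊆ Q → count Q ≤ count P → Q ⊆ P
count-mono-tight P⊆Q Q≤P i Qi = χ≡1 (trans (∑-mono-≤-tight (λ j → χ-mono (P⊆Q j)) Q≤P i) (cong χ Qi))

count-≤ : ∀ {n} (P : Fin n → Bool) → count P ≤ n
count-≤ P = ≤-trans (count-mono {P = P} {Q = everywhere} (λ _ _ → refl)) (≤-reflexive count-everywhere)

count-split : ∀ {n} (P Q : Fin n → Bool) → count P ≡ count (P ∩ Q) + count (P ∩ not ∘ Q)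
count-split P Q = trans (sum-cong-≗ (λ i → χ-split (P i) (Q i))) (∑-distrib-+ (χ ∘ (P ∩ Q)) (χ ∘ (P ∩ not ∘ Q)))
  where
  χ-split : ∀ a b → χ a ≡ χ (a ∧ b) + χ (a ∧ not b)
  χ-split true  true  = refl
  χ-split true  false = refl
  χ-split false _     = refl

count-pos : ∀ {n} (P : Fin n → Bool) {i} → P i ≡ true → 1 ≤ count P
count-pos P {zero}  Pi = subst (λ b → 1 ≤ χ b + count (P ∘ suc)) (sym Pi) (s≤s z≤n)
count-pos P {suc i} Pi = ≤-trans (count-pos (P ∘ suc) Pi) (m≤n+m _ (χ (P zero)))

count≡0 : ∀ {n} (P : Fin n → Bool) → count P ≡ 0 → ∀ i → P i ≡ false
count≡0 P P≡0 i with P i in Pi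
... | false = refl
... | true  = contradiction (subst (1 ≤_) P≡0 (count-pos P Pi)) λ ()

count-witness : ∀ {n} (P : Fin n → Bool) → 1 ≤ count P → ∃ λ i → P i ≡ true
count-witness {suc n} P 1≤P with P zero in P0
... | true  = zero , P0
... | false = let i , Pi = count-witness (P ∘ suc) 1≤P in suc i , Pi

maximiser : ∀ {n} (P : Fin n → Bool) (d : Fin n → ℕ) →
  (∀ u → P u ≡ false) ⊎ Σ[ v ∈ Fin n ] P v ≡ true × (∀ u → P u ≡ true → d u ≤ d v)
maximiser {zero}  P d = inj₁ λ ()
maximiser {suc n} P d with maximiser (P ∘ suc) (d ∘ suc) | P zero in P0
... | inj₁ none | false = inj₁ λ { zero → P0 ; (suc u) → none u }
... | inj₁ none | true  = inj₂ (zero , P0 , λ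
  { zero _ → ≤-refl ; (suc u) Pu → contradiction (trans (sym Pu) (none u)) λ () })
... | inj₂ (v , Pv , max) | false = inj₂ (suc v , Pv , λ
  { zero Pu → contradiction (trans (sym Pu) P0) λ () ; (suc u) → max u })
... | inj₂ (v , Pv , max) | true with d zero ≤? d (suc v)
...   | yes d0≤dv = inj₂ (suc v , Pv , λ { zero _ → d0≤dv ; (suc u) → max u })
...   | no  d0≰dv = inj₂ (zero , P0 , λ
  { zero _ → ≤-refl ; (suc u) Pu → ≤-trans (max u Pu) (<⇒≤ (≰⇒> d0≰dv)) })

length-filter-tabulate : ∀ {B : Set} {n} (Q : B → Bool) (f : Fin n → B) →
  length (filter (λ x → Q x Bool.≟ true) (tabulate f)) ≡ count (Q ∘ f)
length-filter-tabulate {n = zero}  Q f = refl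
length-filter-tabulate {n = suc n} Q f with Q (f zero)
... | true  = cong suc (length-filter-tabulate Q (f ∘ suc))
... | false = length-filter-tabulate Q (f ∘ suc)

degree≡count : ∀ {n} (G : Graph n) u → degree G u ≡ count (adj G u)
degree≡count G u = length-filter-tabulate (adj G u) id

sum-tabulate : ∀ {n} (f : Fin n → ℕ) → List.sum (tabulate f) ≡ sum f
sum-tabulate {zero}  f = refl
sum-tabulate {suc n} f = cong (f zero +_) (sum-tabulate (f ∘ suc))

∑-degree-≡ : ∀ {n m} {G : Graph n} {H : Graph m} → DegreeEquivalent G H →
  ∀ h → ∑[ u < n ] h (degree G u) ≡ ∑[ v < m ] h (degree H v)
∑-degree-≡ {G = G} {H} G≈H h = begin
  ∑[ u < _ ] h (degree G u)        ≡⟨ sum-degreeList G ⟨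
  List.sum (map h (degreeList G)) ≡⟨ sum-↭ (map⁺ h G≈H) ⟩
  List.sum (map h (degreeList H)) ≡⟨ sum-degreeList H ⟩
  ∑[ v < _ ] h (degree H v)        ∎
  where
  open ≡-Reasoning
  sum-degreeList : ∀ {n} (G : Graph n) → List.sum (map h (degreeList G)) ≡ ∑[ u < n ] h (degree G u)
  sum-degreeList {n} G = trans
    (cong List.sum (trans (cong (map h) (List.map-tabulate id (degree G))) (List.map-tabulate (degree G) h)))
    (sum-tabulate (h ∘ degree G))

DegreeEquivalent⇒≡ : ∀ {n m} {G : Graph n} {H : Graph m} → DegreeEquivalent G H → n ≡ m
DegreeEquivalent⇒≡ {G = G} {H} G≈H = trans (sym (length-degreeList G)) (trans (↭-length G≈H) (length-degreeList H))
  where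
  length-degreeList : ∀ {n} (G : Graph n) → length (degreeList G) ≡ n
  length-degreeList {n} G = trans (List.length-map (degree G) (allFin n)) (List.length-tabulate id)

≟-sym : ∀ {k} (x y : Fin k) → does (x ≟ y) ≡ does (y ≟ x)
≟-sym x y = does-⇔ (mk⇔ sym sym) (x ≟ y) (y ≟ x)

multipartite : ∀ {n k} → (Fin n → Fin k) → Fin n → Fin n → Bool
multipartite c u w = not (does (c u ≟ c w))

multipartite-sym : ∀ {n k} (c : Fin n → Fin k) u w → multipartite c u w ≡ multipartite c w u
multipartite-sym c u w = cong not (≟-sym (c u) (c w))

module _ {a} {A : Set a} (_≟ᴬ_ : DecidableEquality A) where

  fibreSize : ∀ {n} → (Fin n → A) → A → ℕ
  fibreSize f z = count (λ i → does (f i ≟ᴬ z))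

  fibreSize-pos : ∀ {n} (f : Fin n → A) {i z} → f i ≡ z → 1 ≤ fibreSize f z
  fibreSize-pos f {i} {z} fi≡z = count-pos (λ i → does (f i ≟ᴬ z)) (dec-true (f i ≟ᴬ z) fi≡z)

  preimage : ∀ {n} (f : Fin n → A) z → 1 ≤ fibreSize f z → ∃ λ i → f i ≡ z
  preimage f z 1≤fz = let i , fi≟z = count-witness _ 1≤fz in i , dec-true⁻¹ fi≟z
    where
    dec-true⁻¹ : ∀ {x y} → does (x ≟ᴬ y) ≡ true → x ≡ y
    dec-true⁻¹ {x} {y} eq with x ≟ᴬ y
    ... | yes x≡y = x≡y

  fibre-permutation : ∀ {n m} (f : Fin n → A) (g : Fin m → A) → (∀ z → fibreSize f z ≡ fibreSize g z) →
    Σ[ π ∈ Permutation n m ] ∀ i → g (π ⟨$⟩ʳ i) ≡ f i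
  fibre-permutation {zero} {zero} f g _ = idₚ , λ ()
  fibre-permutation {zero} {suc m} f g f≈g
    with () ← proj₁ (preimage f (g zero) (subst (1 ≤_) (sym (f≈g (g zero))) (fibreSize-pos g refl)))
  fibre-permutation {suc n} {zero} f g f≈g
    with () ← proj₁ (preimage g (f zero) (subst (1 ≤_) (f≈g (f zero)) (fibreSize-pos f refl)))
  fibre-permutation {suc n} {suc m} f g f≈g
    with j , gj≡f0 ← preimage g (f zero) (subst (1 ≤_) (f≈g (f zero)) (fibreSize-pos f refl)) =
    insert zero j π , λ { zero → gj≡f0 ; (suc i) → trans (cong g (insert-punchIn zero j π i)) (π-respects i) }
    where
    f′≈g′ : ∀ z → fibreSize (f ∘ suc) z ≡ fibreSize (g ∘ punchIn j) z
    f′≈g′ z = +-cancelˡ-≡ (χ (does (f zero ≟ᴬ z))) _ _ (begin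
      fibreSize f z                                               ≡⟨ f≈g z ⟩
      fibreSize g z                                               ≡⟨ sum-remove (λ i → χ (does (g i ≟ᴬ z))) ⟩
      χ (does (g j ≟ᴬ z)) + fibreSize (g ∘ punchIn j) z          ≡⟨ cong (λ x → χ (does (x ≟ᴬ z)) + _) gj≡f0 ⟩
      χ (does (f zero ≟ᴬ z)) + fibreSize (g ∘ punchIn j) z       ∎)
      where open ≡-Reasoning
    π : Permutation n m
    π = proj₁ (fibre-permutation (f ∘ suc) (g ∘ punchIn j) f′≈g′)
    π-respects : ∀ i → g (punchIn j (π ⟨$⟩ʳ i)) ≡ f (suc i)
    π-respects = proj₂ (fibre-permutation (f ∘ suc) (g ∘ punchIn j) f′≈g′)

classSize : ∀ {n k} → (Fin n → Fin k) → Fin k → ℕ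
classSize = fibreSize _≟_

classSize-≤ : ∀ {n k} (c : Fin n → Fin k) j → classSize c j ≤ n
classSize-≤ c j = count-≤ (λ u → does (c u ≟ j))

∑-indicator : ∀ {k} (x : Fin k) (h : Fin k → ℕ) → ∑[ j < k ] (χ (does (x ≟ j)) * h j) ≡ h x
∑-indicator {suc k} zero    h = trans (cong₂ _+_ (+-identityʳ (h zero)) (sum-replicate-zero k)) (+-identityʳ (h zero))
∑-indicator {suc k} (suc x) h = ∑-indicator x (h ∘ suc)

∑-by-classes : ∀ {n k} (c : Fin n → Fin k) (h : Fin k → ℕ) →
  ∑[ u < n ] h (c u) ≡ ∑[ j < k ] (classSize c j * h j)
∑-by-classes {n} {k} c h = begin
  ∑[ u < n ] h (c u)                              ≡⟨ sum-cong-≗ (λ u → ∑-indicator (c u) h) ⟨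
  ∑[ u < n ] ∑[ j < k ] (χ (does (c u ≟ j)) * h j)  ≡⟨ ∑-comm (λ u j → χ (does (c u ≟ j)) * h j) ⟩
  ∑[ j < k ] ∑[ u < n ] (χ (does (c u ≟ j)) * h j)  ≡⟨ sum-cong-≗ (λ j → *-distribʳ-sum (h j) (λ u → χ (does (c u ≟ j)))) ⟨
  ∑[ j < k ] (classSize c j * h j)                  ∎
  where open ≡-Reasoning

multipartite-degree : ∀ {n k} (G : Graph n) (c : Fin n → Fin k) → (∀ u w → adj G u w ≡ multipartite c u w) →
  ∀ u → degree G u + classSize c (c u) ≡ n
multipartite-degree {n} G c G-multipartite u = begin
  degree G u + classSize c (c u)                              ≡⟨ cong (_+ classSize c (c u)) (trans (degree≡count G u) (count-cong adj≡)) ⟩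
  count (not ∘ sameClass) + classSize c (c u)                  ≡⟨ +-comm (count (not ∘ sameClass)) _ ⟩
  classSize c (c u) + count (not ∘ sameClass)                  ≡⟨ count-split everywhere sameClass ⟨
  count {n} everywhere                                         ≡⟨ count-everywhere ⟩
  n                                                            ∎
  where
  open ≡-Reasoning
  sameClass : Fin n → Bool
  sameClass w = does (c w ≟ c u)
  adj≡ : ∀ w → adj G u w ≡ not (sameClass w)
  adj≡ w = trans (G-multipartite u w) (multipartite-sym c u w)

multipartite-classSize : ∀ {n k} (G : Graph n) (c : Fin n → Fin k) → (∀ u w → adj G u w ≡ multipartite c u w) →
  ∀ u → classSize c (c u) ≡ n ∸ degree G u
multipartite-classSize G c G-multipartite u =
  sym (trans (cong (_∸ degree G u) (sym (multipartite-degree G c G-multipartite u))) (m+n∸m≡n (degree G u) _))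

-- Erdős' theorem

extendColour : ∀ {r} → Bool → Fin r → Fin (suc r)
extendColour true  x = inject₁ x
extendColour false _ = fromℕ _

extendColour-≟-fromℕ : ∀ {r} b (x : Fin r) → does (extendColour b x ≟ fromℕ r) ≡ not b
extendColour-≟-fromℕ true  x = dec-false (inject₁ x ≟ fromℕ _) (fromℕ≢inject₁ ∘ sym)
extendColour-≟-fromℕ {r} false x = dec-true (fromℕ r ≟ fromℕ r) refl

extendColour-≟-inject₁ : ∀ {r} b (x y : Fin r) → does (extendColour b x ≟ inject₁ y) ≡ b ∧ does (x ≟ y)
extendColour-≟-inject₁ true  x y = does-⇔ (mk⇔ inject₁-injective (cong inject₁)) (inject₁ x ≟ inject₁ y) (x ≟ y)
extendColour-≟-inject₁ false x y = dec-false (fromℕ _ ≟ inject₁ y) fromℕ≢inject₁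

-- n ∸ classSize colour (colour u) is the degree of u in the complete multipartite graph of the colour classes.
record DominatingColouring {n} (G : Graph n) (k : ℕ) : Set where
  field
    colour    : Fin n → Fin k
    dominated : ∀ u → degree G u + classSize colour (colour u) ≤ n
    rigid     : (∀ u → degree G u + classSize colour (colour u) ≡ n) →
                ∀ u w → adj G u w ≡ multipartite colour u w

module _ {n} (G : Graph n) where

  degreeIn : (Fin n → Bool) → Fin n → ℕ
  degreeIn P u = count (P ∩ adj G u)

  classIn : ∀ {k} → (Fin n → Bool) → (Fin n → Fin k) → Fin n → ℕ
  classIn P c u = count (P ∩ λ w → does (c w ≟ c u))

  degreeIn-≤ : ∀ P u → degreeIn P u ≤ count P
  degreeIn-≤ P u = count-mono (λ w → ∧-conicalˡ (P w) (adj G u w))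

  degreeIn-split : ∀ P Q u → degreeIn P u ≡ degreeIn (P ∩ Q) u + degreeIn (P ∩ not ∘ Q) u
  degreeIn-split P Q u = trans (count-split (P ∩ adj G u) Q)
    (cong₂ _+_ (count-cong (λ w → swap (P w) (adj G u w) (Q w))) (count-cong (λ w → swap (P w) (adj G u w) (not (Q w)))))
    where
    swap : ∀ a b c → (a ∧ b) ∧ c ≡ (a ∧ c) ∧ b
    swap true  b c = ∧-comm b c
    swap false b c = refl

  degreeIn≡count⇒adj : ∀ P u → degreeIn P u ≡ count P → ∀ w → P w ≡ true → adj G u w ≡ true
  degreeIn≡count⇒adj P u d≡P w Pw =
    ∧-conicalʳ (P w) (adj G u w) (count-mono-tight (λ w → ∧-conicalˡ (P w) (adj G u w)) (≤-reflexive (sym d≡P)) w Pw)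

  adj⇒degreeIn≡count : ∀ P u → (∀ w → P w ≡ true → adj G u w ≡ true) → degreeIn P u ≡ count P
  adj⇒degreeIn≡count P u P⊆N = count-cong pointwise
    where
    pointwise : ∀ w → P w ∧ adj G u w ≡ P w
    pointwise w with P w in Pw
    ... | true  = P⊆N w Pw
    ... | false = refl

  degreeIn≡0⇒¬adj : ∀ P u → degreeIn P u ≡ 0 → ∀ w → P w ≡ true → adj G u w ≡ false
  degreeIn≡0⇒¬adj P u d≡0 w Pw = subst (λ b → b ∧ adj G u w ≡ false) Pw (count≡0 (P ∩ adj G u) d≡0 w)

  -- Relative to a vertex set P, so that the induction can pass to the neighbourhood of a vertex.
  record DominatingColouringIn (P : Fin n → Bool) (r : ℕ) : Set where
    field
      colour    : Fin n → Fin r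
      dominated : ∀ u → P u ≡ true → degreeIn P u + classIn P colour u ≤ count P
      rigid     : (∀ u → P u ≡ true → degreeIn P u + classIn P colour u ≡ count P) →
                  ∀ u w → P u ≡ true → P w ≡ true → adj G u w ≡ multipartite colour u w

  CliqueIn : (Fin n → Bool) → ℕ → Set
  CliqueIn P s = Σ[ K ∈ HasClique G s ] ∀ i → P (proj₁ K i) ≡ true

  singletonClique : ∀ {P w} → P w ≡ true → CliqueIn P 1
  singletonClique {w = w} Pw = ((λ _ → w) , (λ { {zero} {zero} _ → refl }) , (λ { zero zero 0≢0 → contradiction refl 0≢0 })) , λ _ → Pw

  extendClique : ∀ {P v s} → P v ≡ true → CliqueIn (P ∩ adj G v) s → CliqueIn P (suc s)
  extendClique {P} {v} Pv ((f , f-injective , f-adjacent) , f⊆N) = (v ◂ f , injective , adjacent) , inside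
    where
    open Vector using () renaming (_∷_ to _◂_)
    v~f : ∀ i → adj G v (f i) ≡ true
    v~f i = ∧-conicalʳ (P (f i)) _ (f⊆N i)
    v≢f : ∀ i → v ≢ f i
    v≢f i v≡fi = contradiction (trans (sym (v~f i)) (trans (cong (adj G v) (sym v≡fi)) (adj-irrefl G v))) λ ()
    injective : ∀ {i j} → (v ◂ f) i ≡ (v ◂ f) j → i ≡ j
    injective {zero}  {zero}  _  = refl
    injective {zero}  {suc j} eq = contradiction eq (v≢f j)
    injective {suc i} {zero}  eq = contradiction (sym eq) (v≢f i)
    injective {suc i} {suc j} eq = cong suc (f-injective eq)
    adjacent : ∀ i j → i ≢ j → adj G ((v ◂ f) i) ((v ◂ f) j) ≡ true
    adjacent zero    zero    0≢0 = contradiction refl 0≢0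
    adjacent zero    (suc j) _   = v~f j
    adjacent (suc i) zero    _   = trans (adj-sym G (f i) v) (v~f i)
    adjacent (suc i) (suc j) i≢j = f-adjacent i j (i≢j ∘ cong suc)
    inside : ∀ i → P ((v ◂ f) i) ≡ true
    inside zero    = Pv
    inside (suc i) = ∧-conicalˡ _ _ (f⊆N i)

  isolatedColouring : ∀ {P r} → (∀ u → P u ≡ true → degreeIn P u ≡ 0) → DominatingColouringIn P (suc r)
  isolatedColouring {P} isolated = record
    { colour    = λ _ → zero
    ; dominated = λ u Pu → ≤-reflexive (cong₂ _+_ (isolated u Pu) (count-cong (λ w → ∧-identityʳ (P w))))
    ; rigid     = λ _ u w Pu Pw → degreeIn≡0⇒¬adj P u (isolated u Pu) w Pw
    }

  -- Erdős' step: colour the non-neighbours S of a vertex v of maximum degree with a new colour.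
  -- A vertex of N has at most |S| neighbours in S; a vertex of S has at most deg v = |N| neighbours.
  module ErdősStep {P : Fin n → Bool} {v : Fin n} (Pv : P v ≡ true)
                   (v-maximal : ∀ u → P u ≡ true → degreeIn P u ≤ degreeIn P v)
                   {r} (colouringN : DominatingColouringIn (P ∩ adj G v) r) where

    N S : Fin n → Bool
    N = P ∩ adj G v
    S = P ∩ not ∘ adj G v

    |P|≡|N|+|S| : count P ≡ count N + count S
    |P|≡|N|+|S| = count-split P (adj G v)

    open DominatingColouringIn colouringN renaming (colour to c′; dominated to dominated′; rigid to rigid′)

    c : Fin n → Fin (suc r)
    c u = extendColour (adj G v u) (c′ u)

    sameColour-N : ∀ {u w} → adj G v w ≡ true → does (c u ≟ c w) ≡ adj G v u ∧ does (c′ u ≟ c′ w)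
    sameColour-N {u} {w} vw = trans (cong (λ b → does (c u ≟ extendColour b (c′ w))) vw)
      (extendColour-≟-inject₁ (adj G v u) (c′ u) (c′ w))

    sameColour-S : ∀ {u w} → adj G v w ≡ false → does (c u ≟ c w) ≡ not (adj G v u)
    sameColour-S {u} {w} vw = trans (cong (λ b → does (c u ≟ extendColour b (c′ w))) vw)
      (extendColour-≟-fromℕ (adj G v u) (c′ u))

    class-N : ∀ {u} → adj G v u ≡ true → classIn P c u ≡ classIn N c′ u
    class-N vu = count-cong (λ w → trans (cong (P w ∧_) (sameColour-N vu)) (sym (∧-assoc (P w) _ _)))

    class-S : ∀ {u} → adj G v u ≡ false → classIn P c u ≡ count S
    class-S vu = count-cong (λ w → cong (P w ∧_) (sameColour-S vu))

    N-bound : ∀ u → P u ≡ true → adj G v u ≡ true →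
      degreeIn P u + classIn P c u ≡ (degreeIn N u + classIn N c′ u) + degreeIn S u
    N-bound u Pu vu = begin
      degreeIn P u + classIn P c u                ≡⟨ cong₂ _+_ (degreeIn-split P (adj G v) u) (class-N vu) ⟩
      degreeIn N u + degreeIn S u + classIn N c′ u ≡⟨ xy∙z≈xz∙y +-commutativeSemigroup (degreeIn N u) _ _ ⟩
      degreeIn N u + classIn N c′ u + degreeIn S u ∎
      where open ≡-Reasoning

    dominated : ∀ u → P u ≡ true → degreeIn P u + classIn P c u ≤ count P
    dominated u Pu = dominated-by (adj G v u) refl
      where
      open ≤-Reasoning
      dominated-by : ∀ b → adj G v u ≡ b → degreeIn P u + classIn P c u ≤ count P
      dominated-by true vu = begin
        degreeIn P u + classIn P c u                  ≡⟨ N-bound u Pu vu ⟩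
        (degreeIn N u + classIn N c′ u) + degreeIn S u ≤⟨ +-mono-≤ (dominated′ u (cong₂ _∧_ Pu vu)) (degreeIn-≤ S u) ⟩
        count N + count S                             ≡⟨ |P|≡|N|+|S| ⟨
        count P                                       ∎
      dominated-by false vu = begin
        degreeIn P u + classIn P c u ≡⟨ cong (degreeIn P u +_) (class-S vu) ⟩
        degreeIn P u + count S       ≤⟨ +-monoˡ-≤ (count S) (v-maximal u Pu) ⟩
        count N + count S            ≡⟨ |P|≡|N|+|S| ⟨
        count P                      ∎

    module _ (tight : ∀ u → P u ≡ true → degreeIn P u + classIn P c u ≡ count P) where

      N-tight : ∀ u → N u ≡ true → (degreeIn N u + classIn N c′ u ≡ count N) × (degreeIn S u ≡ count S)
      N-tight u Nu = +-mono-≤-tight (dominated′ u Nu) (degreeIn-≤ S u)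
        (trans (sym (N-bound u Pu vu)) (trans (tight u Pu) |P|≡|N|+|S|))
        where
        Pu : P u ≡ true
        Pu = ∧-conicalˡ (P u) _ Nu
        vu : adj G v u ≡ true
        vu = ∧-conicalʳ (P u) _ Nu

      S-isolated : ∀ u → P u ≡ true → adj G v u ≡ false → degreeIn S u ≡ 0
      S-isolated u Pu vu = +-cancelˡ-≡ (count N) _ _ (begin
        count N + degreeIn S u      ≡⟨ cong (_+ degreeIn S u) N⊆neighbours ⟨
        degreeIn N u + degreeIn S u ≡⟨ degreeIn-split P (adj G v) u ⟨
        degreeIn P u                ≡⟨ +-cancelʳ-≡ (count S) _ _ (trans (cong (degreeIn P u +_) (sym (class-S vu)))
                                                                     (trans (tight u Pu) |P|≡|N|+|S|)) ⟩
        count N                     ≡⟨ +-identityʳ (count N) ⟨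
        count N + 0                 ∎)
        where
        open ≡-Reasoning
        N⊆neighbours : degreeIn N u ≡ count N
        N⊆neighbours = adj⇒degreeIn≡count N u (λ w Nw →
          trans (adj-sym G u w) (degreeIn≡count⇒adj S w (proj₂ (N-tight w Nw)) u (cong₂ _∧_ Pu (cong not vu))))

      N~S : ∀ {u w} → P u ≡ true → adj G v u ≡ true → P w ≡ true → adj G v w ≡ false →
            adj G u w ≡ multipartite c u w
      N~S {u} {w} Pu vu Pw vw = trans
        (degreeIn≡count⇒adj S u (proj₂ (N-tight u (cong₂ _∧_ Pu vu))) w (cong₂ _∧_ Pw (cong not vw)))
        (cong not (sym (trans (sameColour-S vw) (cong not vu))))

      rigid : ∀ u w → P u ≡ true → P w ≡ true → adj G u w ≡ multipartite c u w
      rigid u w Pu Pw = rigid-by (adj G v u) (adj G v w) refl refl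
        where
        rigid-by : ∀ a b → adj G v u ≡ a → adj G v w ≡ b → adj G u w ≡ multipartite c u w
        rigid-by true true vu vw = trans
          (rigid′ (λ u Nu → proj₁ (N-tight u Nu)) u w (cong₂ _∧_ Pu vu) (cong₂ _∧_ Pw vw))
          (cong not (sym (trans (sameColour-N vw) (cong (_∧ does (c′ u ≟ c′ w)) vu))))
        rigid-by true  false vu vw = N~S Pu vu Pw vw
        rigid-by false true  vu vw = trans (adj-sym G u w) (trans (N~S Pw vw Pu vu) (multipartite-sym c w u))
        rigid-by false false vu vw = trans
          (degreeIn≡0⇒¬adj S u (S-isolated u Pu vu) w (cong₂ _∧_ Pw (cong not vw)))
          (cong not (sym (trans (sameColour-S vw) (cong not vu))))

    extendColouring : DominatingColouringIn P (suc r)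
    extendColouring = record { colour = c ; dominated = dominated ; rigid = rigid }

  erdősIn : ∀ r P → CliqueIn P (2 + r) ⊎ DominatingColouringIn P (suc r)
  erdősIn r P with maximiser P (degreeIn P)
  ... | inj₁ empty = inj₂ (isolatedColouring (λ u Pu → contradiction (trans (sym Pu) (empty u)) λ ()))
  erdősIn zero P | inj₂ (v , Pv , v-maximal) with degreeIn P v in dv
  ... | zero  = inj₂ (isolatedColouring (λ u Pu → n≤0⇒n≡0 (v-maximal u Pu)))
  ... | suc _ = let w , Nw = count-witness (P ∩ adj G v) (subst (1 ≤_) (sym dv) (s≤s z≤n))
                in inj₁ (extendClique {P} Pv (singletonClique {P ∩ adj G v} Nw))
  erdősIn (suc r) P | inj₂ (v , Pv , v-maximal) with erdősIn r (P ∩ adj G v)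
  ... | inj₁ clique    = inj₁ (extendClique {P} Pv clique)
  ... | inj₂ colouring = inj₂ (ErdősStep.extendColouring Pv v-maximal colouring)

  erdős : ∀ r → HasClique G (2 + r) ⊎ DominatingColouring G (suc r)
  erdős r with erdősIn r everywhere
  ... | inj₁ (clique , _) = inj₁ clique
  ... | inj₂ colouring    = inj₂ (record
    { colour    = colour
    ; dominated = λ u → subst₂ _≤_ (cong (_+ _) (sym (degree≡count G u))) count-everywhere (dominated u refl)
    ; rigid     = λ tight u w → rigid (λ u _ → trans (cong (_+ _) (sym (degree≡count G u)))
                                                     (trans (tight u) (sym count-everywhere))) u w refl refl
    })
    where open DominatingColouringIn colouring

-- Weighted degree sums

-- An integer stand-in for 1/x on 1 ≤ x ≤ m; the value at 0 is junk.
weight : ℕ → ℕ → ℕ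
weight m zero    = 0
weight m (suc x) = m ! / suc x

m∣n! : ∀ {m n} → 1 ≤ m → m ≤ n → m ∣ n !
m∣n! {suc m} _ m≤n = ∣-trans (m∣m*n (m !)) (m≤n⇒m!∣n! m≤n)

*-weight : ∀ {m x} → 1 ≤ x → x ≤ m → x * weight m x ≡ m !
*-weight {x = suc x} 1≤x x≤m = m*[n/m]≡n (m∣n! 1≤x x≤m)

*-weight-≤ : ∀ {m x} → x ≤ m → x * weight m x ≤ m !
*-weight-≤ {x = zero}  _   = z≤n
*-weight-≤ {x = suc x} x≤m = ≤-reflexive (*-weight (s≤s z≤n) x≤m)

weight-antitone : ∀ m {x y} → 1 ≤ x → x ≤ y → weight m y ≤ weight m x
weight-antitone m {suc x} {suc y} _ x≤y = /-monoʳ-≤ (m !) x≤y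

weight-injective : ∀ {m x y} → 1 ≤ x → x ≤ m → 1 ≤ y → y ≤ m → weight m x ≡ weight m y → x ≡ y
weight-injective {m} {x} {y} 1≤x x≤m 1≤y y≤m wx≡wy = *-cancelʳ-≡ x y (weight m x) {{weight≢0}}
  (trans (*-weight 1≤x x≤m) (sym (trans (cong (y *_) wx≡wy) (*-weight 1≤y y≤m))))
  where
  weight≢0 : NonZero (weight m x)
  weight≢0 = ≢-nonZero λ w≡0 → contradiction
    (subst (1 ≤_) (trans (sym (*-weight 1≤x x≤m)) (trans (cong (x *_) w≡0) (*-zeroʳ x))) (1≤n! m)) λ ()

module _ {m k} {G K : Graph m} {p : Fin m → Fin k}
         (K-multipartite : ∀ u w → adj K u w ≡ multipartite p u w)
         (p-onto : ∀ j → 1 ≤ classSize p j)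
         (G≈K : DegreeEquivalent G K) where

  ∑-weight-codegree : ∑[ u < m ] weight m (m ∸ degree G u) ≡ k * m !
  ∑-weight-codegree = begin
    ∑[ u < m ] weight m (m ∸ degree G u)                     ≡⟨ ∑-degree-≡ {G = G} {H = K} G≈K (λ d → weight m (m ∸ d)) ⟩
    ∑[ v < m ] weight m (m ∸ degree K v)                     ≡⟨ sum-cong-≗ (λ v → cong (weight m) (multipartite-classSize K p K-multipartite v)) ⟨
    ∑[ v < m ] weight m (classSize p (p v))                  ≡⟨ ∑-by-classes p (λ j → weight m (classSize p j)) ⟩
    ∑[ j < k ] (classSize p j * weight m (classSize p j))    ≡⟨ sum-cong-≗ (λ j → *-weight (p-onto j) (classSize-≤ p j)) ⟩
    ∑[ j < k ] (m !)                                         ≡⟨ ∑-const k (m !) ⟩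
    k * m !                                                  ∎
    where open ≡-Reasoning

  dominating-tight : (colouring : DominatingColouring G k) → let open DominatingColouring colouring in
    (∀ u → degree G u + classSize colour (colour u) ≡ m) × (∀ j → 1 ≤ classSize colour j)
  dominating-tight colouring = tight , c-onto
    where
    open DominatingColouring colouring renaming (colour to c)
    open ≤-Reasoning

    s : Fin k → ℕ
    s = classSize c

    codegree : Fin m → ℕ
    codegree u = m ∸ degree G u

    s≤codegree : ∀ u → s (c u) ≤ codegree u
    s≤codegree u = m+n≤o⇒m≤o∸n (s (c u)) (subst (_≤ m) (+-comm (degree G u) _) (dominated u))

    s≥1 : ∀ u → 1 ≤ s (c u)
    s≥1 u = fibreSize-pos _≟_ c refl

    weights-≤ : ∀ u → weight m (codegree u) ≤ weight m (s (c u))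
    weights-≤ u = weight-antitone m (s≥1 u) (s≤codegree u)

    Σ-classes : ∑[ u < m ] weight m (s (c u)) ≡ ∑[ j < k ] (s j * weight m (s j))
    Σ-classes = ∑-by-classes c (λ j → weight m (s j))

    Σ-classes-≤ : ∑[ j < k ] (s j * weight m (s j)) ≤ ∑[ j < k ] (m !)
    Σ-classes-≤ = ∑-mono-≤ (λ j → *-weight-≤ (classSize-≤ c j))

    Σ-codegree-≥ : ∑[ j < k ] (m !) ≤ ∑[ u < m ] weight m (codegree u)
    Σ-codegree-≥ = ≤-reflexive (trans (∑-const k (m !)) (sym ∑-weight-codegree))

    weight≡ : ∀ u → weight m (codegree u) ≡ weight m (s (c u))
    weight≡ = ∑-mono-≤-tight weights-≤ (begin
      ∑[ u < m ] weight m (s (c u))       ≡⟨ Σ-classes ⟩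
      ∑[ j < k ] (s j * weight m (s j))   ≤⟨ Σ-classes-≤ ⟩
      ∑[ j < k ] (m !)                    ≤⟨ Σ-codegree-≥ ⟩
      ∑[ u < m ] weight m (codegree u)    ∎)

    tight : ∀ u → degree G u + s (c u) ≡ m
    tight u = trans (cong (degree G u +_) s≡codegree) (m+[n∸m]≡n (m+n≤o⇒m≤o (degree G u) (dominated u)))
      where
      codegree≤m : codegree u ≤ m
      codegree≤m = m∸n≤m m (degree G u)
      s≡codegree : s (c u) ≡ codegree u
      s≡codegree = weight-injective (s≥1 u) (≤-trans (s≤codegree u) codegree≤m)
                                    (≤-trans (s≥1 u) (s≤codegree u)) codegree≤m (sym (weight≡ u))

    c-onto : ∀ j → 1 ≤ s j
    c-onto j = positive (s j) (∑-mono-≤-tight (λ j → *-weight-≤ (classSize-≤ c j)) (begin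
      ∑[ j < k ] (m !)                    ≤⟨ Σ-codegree-≥ ⟩
      ∑[ u < m ] weight m (codegree u)    ≤⟨ ∑-mono-≤ weights-≤ ⟩
      ∑[ u < m ] weight m (s (c u))       ≡⟨ Σ-classes ⟩
      ∑[ j < k ] (s j * weight m (s j))   ∎) j)
      where
      positive : ∀ x → x * weight m x ≡ m ! → 1 ≤ x
      positive zero    0≡m! = contradiction (subst (1 ≤_) (sym 0≡m!) (1≤n! m)) λ ()
      positive (suc x) _    = s≤s z≤n

classSize-counts : ∀ {n k} (c : Fin n → Fin k) t →
  count (λ u → does (classSize c (c u) ℕ.≟ t)) ≡ t * count (λ j → does (classSize c j ℕ.≟ t))
classSize-counts {k = k} c t = begin
  count (λ u → does (classSize c (c u) ℕ.≟ t))                    ≡⟨ ∑-by-classes c (λ j → χ (does (classSize c j ℕ.≟ t))) ⟩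
  ∑[ j < k ] (classSize c j * χ (does (classSize c j ℕ.≟ t)))     ≡⟨ sum-cong-≗ (λ j → only-t (classSize c j)) ⟩
  ∑[ j < k ] (t * χ (does (classSize c j ℕ.≟ t)))                 ≡⟨ *-distribˡ-sum t (λ j → χ (does (classSize c j ℕ.≟ t))) ⟨
  t * count (λ j → does (classSize c j ℕ.≟ t))                    ∎
  where
  open ≡-Reasoning
  only-t : ∀ x → x * χ (does (x ℕ.≟ t)) ≡ t * χ (does (x ℕ.≟ t))
  only-t x with x ℕ.≟ t
  ... | yes refl = refl
  ... | no  x≢t  = subst (λ b → x * χ b ≡ t * χ b) (sym (dec-false (x ℕ.≟ t) x≢t))
                          (trans (*-zeroʳ x) (sym (*-zeroʳ t)))

⟨$⟩ʳ-≟ : ∀ {m n} (π : Permutation m n) x y → does (π ⟨$⟩ʳ x ≟ y) ≡ does (x ≟ π ⟨$⟩ˡ y)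
⟨$⟩ʳ-≟ π x y = does-⇔
  (mk⇔ (λ πx≡y → trans (sym (inverseˡ π)) (cong (π ⟨$⟩ˡ_) πx≡y)) (λ x≡π⁻¹y → trans (cong (π ⟨$⟩ʳ_) x≡π⁻¹y) (inverseʳ π)))
  (π ⟨$⟩ʳ x ≟ y) (x ≟ π ⟨$⟩ˡ y)

-- The degree sequence determines the number of classes of each size, and these numbers determine the classes up to relabelling.
module _ {m k} {G K : Graph m} {c p : Fin m → Fin k}
         (G-multipartite : ∀ u w → adj G u w ≡ multipartite c u w)
         (K-multipartite : ∀ u w → adj K u w ≡ multipartite p u w)
         (c-onto : ∀ j → 1 ≤ classSize c j)
         (p-onto : ∀ j → 1 ≤ classSize p j)
         (G≈K : DegreeEquivalent G K) where

  classSize-counts-≡ : ∀ t → count (λ j → does (classSize c j ℕ.≟ t)) ≡ count (λ j → does (classSize p j ℕ.≟ t))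
  classSize-counts-≡ zero = trans (no-empty-class c c-onto) (sym (no-empty-class p p-onto))
    where
    no-empty-class : ∀ c → (∀ j → 1 ≤ classSize c j) → count (λ j → does (classSize c j ℕ.≟ 0)) ≡ 0
    no-empty-class c onto = count-nowhere (λ j →
      dec-false (classSize c j ℕ.≟ 0) (λ s≡0 → contradiction (subst (1 ≤_) s≡0 (onto j)) λ ()))
  classSize-counts-≡ (suc t) = *-cancelˡ-≡ _ _ (suc t) (begin
    suc t * count (λ j → does (classSize c j ℕ.≟ suc t)) ≡⟨ classSize-counts c (suc t) ⟨
    count (λ u → does (classSize c (c u) ℕ.≟ suc t))     ≡⟨ count-cong (λ u → cong (λ x → does (x ℕ.≟ suc t)) (multipartite-classSize G c G-multipartite u)) ⟩
    count (λ u → does ((m ∸ degree G u) ℕ.≟ suc t))      ≡⟨ ∑-degree-≡ {G = G} {H = K} G≈K (λ d → χ (does ((m ∸ d) ℕ.≟ suc t))) ⟩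
    count (λ v → does ((m ∸ degree K v) ℕ.≟ suc t))      ≡⟨ count-cong (λ v → cong (λ x → does (x ℕ.≟ suc t)) (multipartite-classSize K p K-multipartite v)) ⟨
    count (λ v → does (classSize p (p v) ℕ.≟ suc t))     ≡⟨ classSize-counts p (suc t) ⟩
    suc t * count (λ j → does (classSize p j ℕ.≟ suc t)) ∎)
    where open ≡-Reasoning

  multipartite-isomorphic : Isomorphic G K
  multipartite-isomorphic = ↔⇒⤖ φ , preserves
    where
    open ≡-Reasoning
    π : Permutation k k
    π = proj₁ (fibre-permutation ℕ._≟_ (classSize c) (classSize p) classSize-counts-≡)
    π-size : ∀ j → classSize p (π ⟨$⟩ʳ j) ≡ classSize c j
    π-size = proj₂ (fibre-permutation ℕ._≟_ (classSize c) (classSize p) classSize-counts-≡)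
    fibres : ∀ z → classSize (λ u → π ⟨$⟩ʳ c u) z ≡ classSize p z
    fibres z = begin
      classSize (λ u → π ⟨$⟩ʳ c u) z   ≡⟨ count-cong (λ u → ⟨$⟩ʳ-≟ π (c u) z) ⟩
      classSize c (π ⟨$⟩ˡ z)           ≡⟨ π-size (π ⟨$⟩ˡ z) ⟨
      classSize p (π ⟨$⟩ʳ (π ⟨$⟩ˡ z))  ≡⟨ cong (classSize p) (inverseʳ π) ⟩
      classSize p z                    ∎
    φ : Permutation m m
    φ = proj₁ (fibre-permutation _≟_ (λ u → π ⟨$⟩ʳ c u) p fibres)
    φ-colour : ∀ u → p (φ ⟨$⟩ʳ u) ≡ π ⟨$⟩ʳ c u
    φ-colour = proj₂ (fibre-permutation _≟_ (λ u → π ⟨$⟩ʳ c u) p fibres)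
    preserves : ∀ u w → adj K (φ ⟨$⟩ʳ u) (φ ⟨$⟩ʳ w) ≡ adj G u w
    preserves u w = begin
      adj K (φ ⟨$⟩ʳ u) (φ ⟨$⟩ʳ w)                  ≡⟨ K-multipartite _ _ ⟩
      not (does (p (φ ⟨$⟩ʳ u) ≟ p (φ ⟨$⟩ʳ w)))     ≡⟨ cong₂ (λ x y → not (does (x ≟ y))) (φ-colour u) (φ-colour w) ⟩
      not (does (π ⟨$⟩ʳ c u ≟ π ⟨$⟩ʳ c w))         ≡⟨ cong not (trans (⟨$⟩ʳ-≟ π (c u) _) (cong (λ y → does (c u ≟ y)) (inverseˡ π))) ⟩
      multipartite c u w                          ≡⟨ G-multipartite u w ⟨
      adj G u w                                   ∎

completeMultipartite-multipartite : ∀ {k} (as : Vec ℕ k) u w →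
  adj (completeMultipartite as) u w ≡ multipartite (part as) u w
completeMultipartite-multipartite as u w = cong not (isYes≗does (part as u ≟ part as w))

part-inj₂ : ∀ {k} a (as : Vec ℕ k) v w → splitAt a v ≡ inj₂ w → part (a ∷ as) v ≡ suc (part as w)
part-inj₂ a as v w eq with splitAt a v
part-inj₂ a as v w refl | .(inj₂ w) = refl

part-surjective : ∀ {k} (as : Vec ℕ k) → All (_> 0) as → ∀ j → ∃ λ v → part as v ≡ j
part-surjective (suc a ∷ as) (_ ∷ _)     zero    = zero , refl
part-surjective (a ∷ as)     (_ ∷ as>0) (suc j) =
  let w , part-w≡j = part-surjective as as>0 j
  in a ↑ʳ w , trans (part-inj₂ a as (a ↑ʳ w) w (splitAt-↑ʳ a (total as) w)) (cong suc part-w≡j)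

corollary4 : (k : ℕ) → k ≥ 1 → (as : Vec ℕ k) → All (λ a → a > 0) as →
    (n : ℕ) (G : Graph n) →
    DegreeEquivalent G (completeMultipartite as) →
    ¬ Isomorphic G (completeMultipartite as) →
    HasClique G (suc k)
corollary4 (suc r) _ as as>0 n G G≈K G≇K
  with refl ← DegreeEquivalent⇒≡ {G = G} {H = completeMultipartite as} G≈K | erdős G r
... | inj₁ clique    = clique
... | inj₂ colouring = contradiction
  (multipartite-isomorphic {G = G} {K = completeMultipartite as} {c = colour} {p = part as}
     (rigid (proj₁ tight&onto)) K-multipartite (proj₂ tight&onto) p-onto G≈K)
  G≇K
  where
  open DominatingColouring colouring
  K-multipartite : ∀ u w → adj (completeMultipartite as) u w ≡ multipartite (part as) u w
  K-multipartite = completeMultipartite-multipartite as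
  p-onto : ∀ j → 1 ≤ classSize (part as) j
  p-onto j = fibreSize-pos _≟_ (part as) (proj₂ (part-surjective as as>0 j))
  tight&onto : (∀ u → degree G u + classSize colour (colour u) ≡ total as) × (∀ j → 1 ≤ classSize colour j)
  tight&onto = dominating-tight {G = G} {K = completeMultipartite as} {p = part as} K-multipartite p-onto G≈K colouring
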